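{- If $G$ is a graph with a unique maximum open packing, then $G$ has no strong support vertices.
   Context: An open packing in a graph is a set of vertices whose open neighborhoods are pairwise disjoint. A leaf is a vertex of degree 1; its neighbor is its support vertex. A strong support vertex is a vertex adjacent to more than one leaf. -}

module Defs where

open import Data.Nat using (ℕ; _≤_)
open import Data.Fin using (Fin)
open import Data.Fin.Subset using (Subset; _∈_; _∩_; ∣_∣; Empty)
open import Data.Vec using (tabulate)
open import Data.Product using (Σ; ∃; ∃₂; _×_)
open import Relation.Nullary using (¬_; Dec; does)
open import Relation.Binary.PropositionalEquality using (_≡_; _≢_)

record Graph (n : ℕ) : Set₁ where
  field
    Adj     : Fin n → Fin n → Set
    adj?    : ∀ u v → Dec (Adj u v)
    sym     : ∀ {u v} → Adj u v → Adj v u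
    irrefl  : ∀ {u} → ¬ Adj u u

module _ {n : ℕ} (G : Graph n) where
  open Graph G

  N : Fin n → Subset n
  N v = tabulate (λ u → does (adj? v u))

  degree : Fin n → ℕ
  degree v = ∣ N v ∣

  IsLeaf : Fin n → Set
  IsLeaf v = degree v ≡ 1

  IsStrongSupport : Fin n → Set
  IsStrongSupport v = ∃₂ λ a b → a ≢ b × IsLeaf a × IsLeaf b × Adj v a × Adj v b

  IsOpenPacking : Subset n → Set
  IsOpenPacking S = ∀ u v → u ∈ S → v ∈ S → u ≢ v → Empty (N u ∩ N v)

  IsMaximumOpenPacking : Subset n → Set
  IsMaximumOpenPacking S =
    IsOpenPacking S × (∀ T → IsOpenPacking T → ∣ T ∣ ≤ ∣ S ∣)

  HasUniqueMaximumOpenPacking : Set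
  HasUniqueMaximumOpenPacking =
    Σ (Subset n) λ S → IsMaximumOpenPacking S × (∀ T → IsMaximumOpenPacking T → T ≡ S)

-- Let S be the unique maximum open packing and
-- suppose v is adjacent to two distinct leaves a and b.
--   * Two members of an open packing never share a neighbour, so at most one
--     member of S is adjacent to v.  Hence one of the leaves, say x, lies
--     outside S, and there is a vertex u covering every member of S adjacent
--     to v.
--   * The only neighbour of the leaf x is v, so swapping u for x keeps the
--     packing property: T = (S - u) ∪ {x} is again an open packing.
--   * Since x ∉ S we have |S| ≤ |T|, so T is also maximum; by uniqueness
--     T = S, contradicting x ∈ T and x ∉ S.
module Submission where

open import Defs
open import Data.Nat using (ℕ; suc; _+_; _≤_; s≤s; z≤n)
open import Data.Nat.Properties using (≤-trans; ≤-reflexive; +-suc; m≤n⇒m≤1+n; <⇒≱; module ≤-Reasoning)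
open import Data.Fin using (Fin)
open import Data.Fin.Properties using (any?) renaming (_≟_ to _≟ᶠ_)
open import Data.Fin.Subset
open import Data.Fin.Subset.Properties
open import Data.Vec using (_∷_; []; there)
open import Data.Vec.Properties using (lookup⇒[]=; []=⇒lookup; lookup∘tabulate)
open import Data.Product using (∃; _×_; _,_)
open import Data.Sum using (_⊎_; inj₁; inj₂)
open import Data.Bool using (true)
open import Relation.Nullary using (¬_; Dec; yes; no; does; contradiction)
open import Relation.Nullary.Decidable using (dec-true; _×-dec_)
open import Relation.Binary.PropositionalEquality
  using (_≡_; _≢_; refl; sym; trans; subst)

x∈p─q⇒x∉q : ∀ {n} (p q : Subset n) {x : Fin n} → x ∈ p ─ q → x ∉ q
x∈p─q⇒x∉q (_ ∷ p) (outside ∷ q) (there x∈diff) (there x∈q) = x∈p─q⇒x∉q p q x∈diff x∈q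
x∈p─q⇒x∉q (_ ∷ p) (inside  ∷ q) (there x∈diff) (there x∈q) = x∈p─q⇒x∉q p q x∈diff x∈q

∣p∣≤∣q∣+∣p─q∣ : ∀ {n} (p q : Subset n) → ∣ p ∣ ≤ ∣ q ∣ + ∣ p ─ q ∣
∣p∣≤∣q∣+∣p─q∣ []            []            = z≤n
∣p∣≤∣q∣+∣p─q∣ (outside ∷ p) (outside ∷ q) = ∣p∣≤∣q∣+∣p─q∣ p q
∣p∣≤∣q∣+∣p─q∣ (outside ∷ p) (inside  ∷ q) = m≤n⇒m≤1+n (∣p∣≤∣q∣+∣p─q∣ p q)
∣p∣≤∣q∣+∣p─q∣ (inside  ∷ p) (inside  ∷ q) = s≤s (∣p∣≤∣q∣+∣p─q∣ p q)
∣p∣≤∣q∣+∣p─q∣ (inside  ∷ p) (outside ∷ q) =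
  ≤-trans (s≤s (∣p∣≤∣q∣+∣p─q∣ p q)) (≤-reflexive (sym (+-suc ∣ q ∣ ∣ p ─ q ∣)))

∣p∣≤1+∣p-x∣ : ∀ {n} (p : Subset n) (x : Fin n) → ∣ p ∣ ≤ suc ∣ p - x ∣
∣p∣≤1+∣p-x∣ p x = subst (λ k → ∣ p ∣ ≤ k + ∣ p - x ∣) (∣⁅x⁆∣≡1 x) (∣p∣≤∣q∣+∣p─q∣ p ⁅ x ⁆)

-- A subset of size one has at most one element: otherwise p - i would still
-- contain j, making |p - i| ≥ 1 = |p|, while removing i ∈ p shrinks p.
∣p∣≡1⇒unique : ∀ {n} {p : Subset n} {i j : Fin n} → ∣ p ∣ ≡ 1 → i ∈ p → j ∈ p → i ≡ j
∣p∣≡1⇒unique {p = p} {i} {j} ∣p∣≡1 i∈p j∈p with i ≟ᶠ j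
... | yes i≡j = i≡j
... | no  i≢j = contradiction (subst (_≤ ∣ p - i ∣) (∣⁅x⁆∣≡1 j) (p⊆q⇒∣p∣≤∣q∣ ⁅j⁆⊆p-i))
                             (subst (λ k → ¬ k ≤ ∣ p - i ∣) ∣p∣≡1 (<⇒≱ (x∈p⇒∣p-x∣<∣p∣ i∈p)))
  where
  ⁅j⁆⊆p-i : ⁅ j ⁆ ⊆ p - i
  ⁅j⁆⊆p-i k∈⁅j⁆ with refl ← x∈⁅y⁆⇒x≡y j k∈⁅j⁆ = x∈p∧x≢y⇒x∈p-y j∈p (λ j≡i → i≢j (sym j≡i))

exchange : ∀ {n} → Subset n → Fin n → Fin n → Subset n
exchange S u x = (S - u) ∪ ⁅ x ⁆

x∈exchange : ∀ {n} (S : Subset n) (u x : Fin n) → x ∈ exchange S u x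
x∈exchange S u x = x∈p∪q⁺ (inj₂ (x∈⁅x⁆ x))

exchange-member : ∀ {n} {S : Subset n} {u x w : Fin n} →
  w ∈ exchange S u x → (w ∈ S × w ≢ u) ⊎ w ≡ x
exchange-member {S = S} {u} {x} w∈T with x∈p∪q⁻ (S - u) ⁅ x ⁆ w∈T
... | inj₁ w∈S-u = inj₁ (p─q⊆p S ⁅ u ⁆ w∈S-u , λ { refl → x∈p─q⇒x∉q S ⁅ u ⁆ w∈S-u (x∈⁅x⁆ u) })
... | inj₂ w∈⁅x⁆ = inj₂ (x∈⁅y⁆⇒x≡y x w∈⁅x⁆)

exchange-size : ∀ {n} {S : Subset n} {x : Fin n} (u : Fin n) → x ∉ S →
  ∣ S ∣ ≤ ∣ exchange S u x ∣
exchange-size {S = S} {x} u x∉S = begin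
  ∣ S ∣          ≤⟨ ∣p∣≤1+∣p-x∣ S u ⟩
  suc ∣ S - u ∣  ≤⟨ s≤s (p⊆q⇒∣p∣≤∣q∣ S-u⊆T-x) ⟩
  suc ∣ T - x ∣  ≤⟨ x∈p⇒∣p-x∣<∣p∣ (x∈exchange S u x) ⟩
  ∣ T ∣          ∎
  where
  open ≤-Reasoning
  T : Subset _
  T = exchange S u x
  S-u⊆T-x : S - u ⊆ T - x
  S-u⊆T-x w∈S-u = x∈p∧x≢y⇒x∈p-y (x∈p∪q⁺ (inj₁ w∈S-u))
                                 (λ { refl → x∉S (p─q⊆p S ⁅ u ⁆ w∈S-u) })

does-true⇒ : ∀ {A : Set} (a? : Dec A) → does a? ≡ true → A
does-true⇒ (yes a) _  = a
does-true⇒ (no _)  ()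

module _ {n : ℕ} (G : Graph n) where
  open Graph G renaming (sym to adj-sym)

  Adj⇒∈N : ∀ {a y} → Adj a y → y ∈ N G a
  Adj⇒∈N {a} {y} a~y =
    lookup⇒[]= y (N G a) (trans (lookup∘tabulate (λ u → does (adj? a u)) y) (dec-true (adj? a y) a~y))

  ∈N⇒Adj : ∀ {a y} → y ∈ N G a → Adj a y
  ∈N⇒Adj {a} {y} y∈Na = does-true⇒ (adj? a y)
    (trans (sym (lookup∘tabulate (λ u → does (adj? a u)) y)) ([]=⇒lookup y∈Na))

  commonNeighbour : ∀ {a b y} → Adj a y → Adj b y → Nonempty (N G a ∩ N G b)
  commonNeighbour a~y b~y = _ , x∈p∩q⁺ (Adj⇒∈N a~y , Adj⇒∈N b~y)

  packing-atMostOneNeighbour : ∀ {S v w w′} → IsOpenPacking G S →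
    w ∈ S → w′ ∈ S → Adj w v → Adj w′ v → w ≡ w′
  packing-atMostOneNeighbour {w = w} {w′} packS w∈S w′∈S w~v w′~v with w ≟ᶠ w′
  ... | yes w≡w′ = w≡w′
  ... | no  w≢w′ = contradiction (commonNeighbour w~v w′~v) (packS _ _ w∈S w′∈S w≢w′)

  -- Some vertex u covers all members of S adjacent to v (any vertex works when
  -- there are none; v itself is used as the default).
  packing-neighbourCover : ∀ {S} → IsOpenPacking G S → ∀ v →
    ∃ λ u → ∀ w → w ∈ S → Adj w v → w ≡ u
  packing-neighbourCover {S} packS v with any? (λ u → (u ∈? S) ×-dec adj? u v)
  ... | yes (u , u∈S , u~v) = u , λ w w∈S w~v → packing-atMostOneNeighbour packS w∈S u∈S w~v u~v
  ... | no  noNeighbour     = v , λ w w∈S w~v → contradiction (w , w∈S , w~v) noNeighbour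

  -- A leaf's neighbourhood is exactly its support vertex, so the only vertices
  -- whose neighbourhood meets it are the neighbours of that support vertex.
  leaf-meets⇒Adj : ∀ {x v q} → IsLeaf G x → Adj x v → Nonempty (N G x ∩ N G q) → Adj q v
  leaf-meets⇒Adj {x} {v} {q} leaf x~v (y , y∈Nx∩Nq) with x∈p∩q⁻ (N G x) (N G q) y∈Nx∩Nq
  ... | y∈Nx , y∈Nq = subst (Adj q) (∣p∣≡1⇒unique leaf y∈Nx (Adj⇒∈N x~v)) (∈N⇒Adj y∈Nq)

  -- A strong support vertex always has a leaf neighbour outside any open
  -- packing, since its two leaves share it as a neighbour.
  strongSupport⇒leafOutside : ∀ {S v} → IsOpenPacking G S → IsStrongSupport G v →
    ∃ λ x → x ∉ S × IsLeaf G x × Adj x v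
  strongSupport⇒leafOutside {S} packS (a , b , a≢b , leafA , leafB , v~a , v~b) with a ∈? S
  ... | no  a∉S = a , a∉S , leafA , adj-sym v~a
  ... | yes a∈S = b , b∉S , leafB , adj-sym v~b
    where
    b∉S : b ∉ S
    b∉S b∈S = packS a b a∈S b∈S a≢b (commonNeighbour (adj-sym v~a) (adj-sym v~b))

  -- If x is a leaf supported by v, and u covers every member of S adjacent
  -- to v, then exchanging u for x preserves the open packing property: the
  -- only vertices whose neighbourhood meets N(x) = {v} are neighbours of v.
  leafExchange-packing : ∀ {S u x v} → IsOpenPacking G S → IsLeaf G x → Adj x v →
    (∀ w → w ∈ S → Adj w v → w ≡ u) → IsOpenPacking G (exchange S u x)
  leafExchange-packing {S} {u} {x} {v} packS leafX x~v covers = packT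
    where
    leafDisjoint : ∀ {w} → w ∈ S → w ≢ u → Empty (N G x ∩ N G w)
    leafDisjoint w∈S w≢u meets = w≢u (covers _ w∈S (leaf-meets⇒Adj leafX x~v meets))

    packT : IsOpenPacking G (exchange S u x)
    packT p q p∈T q∈T p≢q with exchange-member p∈T | exchange-member q∈T
    ... | inj₁ (p∈S , _)   | inj₁ (q∈S , _)   = packS p q p∈S q∈S p≢q
    ... | inj₂ refl        | inj₁ (q∈S , q≢u) = leafDisjoint q∈S q≢u
    ... | inj₁ (p∈S , p≢u) | inj₂ refl        =
          λ meets → leafDisjoint p∈S p≢u (subst Nonempty (∩-comm (N G p) (N G x)) meets)
    ... | inj₂ refl        | inj₂ refl        = contradiction refl p≢q

  maximum-transfer : ∀ {S T} → IsMaximumOpenPacking G S → IsOpenPacking G T →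
    ∣ S ∣ ≤ ∣ T ∣ → IsMaximumOpenPacking G T
  maximum-transfer (_ , maxS) packT S≤T = packT , λ R packR → ≤-trans (maxS R packR) S≤T

mainTheorem11 : ∀ {n} (G : Graph n) → HasUniqueMaximumOpenPacking G →
    ∀ v → ¬ IsStrongSupport G v
mainTheorem11 G (S , maxS@(packS , _) , unique) v strongV
  with x , x∉S , leafX , x~v ← strongSupport⇒leafOutside G packS strongV
     | u , covers            ← packing-neighbourCover G packS v
  = x∉S (subst (x ∈_) T≡S (x∈exchange S u x))
  where
  T≡S : exchange S u x ≡ S
  T≡S = unique (exchange S u x)
          (maximum-transfer G maxS (leafExchange-packing G packS leafX x~v covers)
                                   (exchange-size u x∉S))
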